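{- Let $p > 3$ be a prime and $m\in\mathbb{F}_p\setminus\{ -1\}$. Then the fundamental block $F(p,m)$ contains at least two zero entries.
   Context: $F(p,m) = (a_{i,j})_{0\le i,j\le p-1}$ is the $p\times p$ matrix over $\mathbb{F}_p$ with $a_{i,0} = a_{0,j}=1$ and $a_{i,j} = a_{i-1,j} + m\,a_{i-1,j-1} + a_{i,j-1}$ for $i,j\ge1$. -}

module Defs where

open import Data.Nat using (ℕ; zero; suc; _+_; _*_; NonZero)
open import Data.Nat.DivMod using (_%_)

-- Entries of the fundamental block F(p,m) over F_p, with F_p represented
-- by residues {0,…,p-1} (ℕ reduced mod p).
--   a(i,0) = a(0,j) = 1,  a(i,j) = a(i-1,j) + m a(i-1,j-1) + a(i,j-1)  (mod p)
entry : (p : ℕ) → .{{NonZero p}} → (m : ℕ) → ℕ → ℕ → ℕ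
entry p m zero    j       = 1 % p
entry p m (suc i) zero    = 1 % p
entry p m (suc i) (suc j) =
  (entry p m i (suc j) + m * entry p m i j + entry p m (suc i) j) % p

-- Over ℕ, the first row and column of the block are 1 + j(m+1). As m ≠ −1, m+1 is a unit
-- mod p, so 1 + j(m+1) ≡ 0 for some j < p, giving zeros at (1,j) and (j,1). They coincide
-- only when j = 1, i.e. m ≡ −2, and then the (3,3) entry (m+2)(m²+10m+10) vanishes too.
module Submission where

open import Defs
open import Data.Nat using (ℕ; _<_; _>_; _∸_; NonZero)
open import Data.Nat.Primality using (Prime)
open import Data.Product using (Σ; _×_; _,_)
open import Relation.Binary.PropositionalEquality using (_≡_; _≢_)
open import Relation.Nullary using (¬_)

open import Data.Nat using (zero; suc; pred; s≤s; z≤n; _+_; _*_; _%_; _≟_)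
open import Data.Nat.Properties using (≤∧≢⇒<; ≤-trans; *-assoc)
open import Data.Nat.DivMod using (%-distribˡ-+; %-distribˡ-*; m%n%n≡m%n; m%n<n)
open import Data.Nat.Divisibility using (_∣_; divides; n∣m⇒m%n≡0; m%n≡0⇒n∣m; ∣m⇒∣m*n)
open import Data.Nat.GCD using (module Bézout)
open import Data.Nat.Coprimality using (Coprime; coprime-Bézout; prime⇒coprime)
open import Data.Nat.Tactic.RingSolver using (solve-∀)
open import Relation.Nullary using (yes; no)
open import Relation.Binary.PropositionalEquality using (refl; sym; trans; cong; cong₂; subst; module ≡-Reasoning)

entryℕ : ℕ → ℕ → ℕ → ℕ
entryℕ m zero    j       = 1
entryℕ m (suc i) zero    = 1
entryℕ m (suc i) (suc j) = entryℕ m i (suc j) + m * entryℕ m i j + entryℕ m (suc i) j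

entryℕ-suc-suc : ∀ m i j {a b c} →
  entryℕ m i (suc j) ≡ a → entryℕ m i j ≡ b → entryℕ m (suc i) j ≡ c →
  entryℕ m (suc i) (suc j) ≡ a + m * b + c
entryℕ-suc-suc m i j refl refl refl = refl

entryℕ-row₁ : ∀ m j → entryℕ m 1 j ≡ 1 + j * suc m
entryℕ-row₁ m zero    = refl
entryℕ-row₁ m (suc j) = trans (entryℕ-suc-suc m 0 j refl refl (entryℕ-row₁ m j)) (step m j)
  where
  step : ∀ m j → 1 + m * 1 + (1 + j * suc m) ≡ 1 + suc j * suc m
  step = solve-∀

entryℕ-col₁ : ∀ m i → entryℕ m i 1 ≡ 1 + i * suc m
entryℕ-col₁ m zero    = refl
entryℕ-col₁ m (suc i) = trans (entryℕ-suc-suc m i 0 (entryℕ-col₁ m i) (entryℕ-col₀ i) refl) (step m i)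
  where
  entryℕ-col₀ : ∀ i → entryℕ m i 0 ≡ 1
  entryℕ-col₀ zero    = refl
  entryℕ-col₀ (suc i) = refl
  step : ∀ m i → 1 + i * suc m + m * 1 + 1 ≡ 1 + suc i * suc m
  step = solve-∀

entryℕ-2-2 : ∀ m → entryℕ m 2 2 ≡ m * m + 6 * m + 6
entryℕ-2-2 m = trans (entryℕ-suc-suc m 1 1 (entryℕ-row₁ m 2) (entryℕ-row₁ m 1) (entryℕ-col₁ m 2)) (step m)
  where
  step : ∀ m → 1 + 2 * suc m + m * (1 + 1 * suc m) + (1 + 2 * suc m) ≡ m * m + 6 * m + 6
  step = solve-∀

entryℕ-2-3 : ∀ m → entryℕ m 2 3 ≡ 3 * (m * m) + 12 * m + 10
entryℕ-2-3 m = trans (entryℕ-suc-suc m 1 2 (entryℕ-row₁ m 3) (entryℕ-row₁ m 2) (entryℕ-2-2 m)) (step m)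
  where
  step : ∀ m → 1 + 3 * suc m + m * (1 + 2 * suc m) + (m * m + 6 * m + 6) ≡ 3 * (m * m) + 12 * m + 10
  step = solve-∀

entryℕ-3-2 : ∀ m → entryℕ m 3 2 ≡ 3 * (m * m) + 12 * m + 10
entryℕ-3-2 m = trans (entryℕ-suc-suc m 2 1 (entryℕ-2-2 m) (entryℕ-col₁ m 2) (entryℕ-col₁ m 3)) (step m)
  where
  step : ∀ m → m * m + 6 * m + 6 + m * (1 + 2 * suc m) + (1 + 3 * suc m) ≡ 3 * (m * m) + 12 * m + 10
  step = solve-∀

entryℕ-3-3 : ∀ m → entryℕ m 3 3 ≡ entryℕ m 1 1 * (m * m + 10 * m + 10)
entryℕ-3-3 m = trans (entryℕ-suc-suc m 2 2 (entryℕ-2-3 m) (entryℕ-2-2 m) (entryℕ-3-2 m)) (step m)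
  where
  step : ∀ m → 3 * (m * m) + 12 * m + 10 + m * (m * m + 6 * m + 6) + (3 * (m * m) + 12 * m + 10)
             ≡ (1 + m * 1 + 1) * (m * m + 10 * m + 10)
  step = solve-∀

coprime⇒∃[j]∣1+j*k : ∀ {p k} .{{_ : NonZero p}} → Coprime p k → Σ ℕ λ j → p ∣ 1 + j * k
coprime⇒∃[j]∣1+j*k {suc q} {k} cop with coprime-Bézout cop
... | Bézout.+- x y 1+yk≡xp = y , divides x 1+yk≡xp
-- (p − 1)(1 + x p) ≡ −1 mod p
... | Bézout.-+ x y 1+xp≡yk = q * y , divides (1 + q * x) (begin
  1 + q * y * k             ≡⟨ cong suc (*-assoc q y k) ⟩
  1 + q * (y * k)           ≡⟨ cong (λ t → 1 + q * t) 1+xp≡yk ⟨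
  1 + q * (1 + x * suc q)   ≡⟨ step q x ⟩
  (1 + q * x) * suc q       ∎)
  where
  open ≡-Reasoning
  step : ∀ q x → 1 + q * (1 + x * suc q) ≡ (1 + q * x) * suc q
  step = solve-∀

module _ (p : ℕ) .{{_ : NonZero p}} where
  open ≡-Reasoning

  %-cong-+ : ∀ {a a′ b b′} → a % p ≡ a′ % p → b % p ≡ b′ % p → (a + b) % p ≡ (a′ + b′) % p
  %-cong-+ {a} {a′} {b} {b′} a≡a′ b≡b′ = begin
    (a + b) % p             ≡⟨ %-distribˡ-+ a b p ⟩
    (a % p + b % p) % p     ≡⟨ cong₂ (λ x y → (x + y) % p) a≡a′ b≡b′ ⟩
    (a′ % p + b′ % p) % p   ≡⟨ %-distribˡ-+ a′ b′ p ⟨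
    (a′ + b′) % p           ∎

  %-cong-* : ∀ {a a′ b b′} → a % p ≡ a′ % p → b % p ≡ b′ % p → (a * b) % p ≡ (a′ * b′) % p
  %-cong-* {a} {a′} {b} {b′} a≡a′ b≡b′ = begin
    (a * b) % p               ≡⟨ %-distribˡ-* a b p ⟩
    (a % p * (b % p)) % p     ≡⟨ cong₂ (λ x y → (x * y) % p) a≡a′ b≡b′ ⟩
    (a′ % p * (b′ % p)) % p   ≡⟨ %-distribˡ-* a′ b′ p ⟨
    (a′ * b′) % p             ∎

  %-cong-% : ∀ {x n} → x ≡ n % p → x % p ≡ n % p
  %-cong-% {n = n} refl = m%n%n≡m%n n p

  entry≡entryℕ% : ∀ m i j → entry p m i j ≡ entryℕ m i j % p
  entry≡entryℕ% m zero    j       = refl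
  entry≡entryℕ% m (suc i) zero    = refl
  entry≡entryℕ% m (suc i) (suc j) =
    %-cong-+ (%-cong-+ (%-cong-% (entry≡entryℕ% m i (suc j)))
                       (%-cong-* {m} refl (%-cong-% (entry≡entryℕ% m i j))))
             (%-cong-% (entry≡entryℕ% m (suc i) j))

  ∣1+j*k⇒∣1+[j%p]*k : ∀ {j k} → p ∣ 1 + j * k → p ∣ 1 + j % p * k
  ∣1+j*k⇒∣1+[j%p]*k {j} {k} p∣1+jk = m%n≡0⇒n∣m _ p (begin
    (1 + j % p * k) % p   ≡⟨ %-cong-+ {1} refl (%-cong-* (m%n%n≡m%n j p) refl) ⟩
    (1 + j * k) % p       ≡⟨ n∣m⇒m%n≡0 _ p p∣1+jk ⟩
    0                     ∎)

  coprime⇒∃[j<p]∣1+j*k : ∀ {k} → Coprime p k → Σ ℕ λ j → j < p × p ∣ 1 + j * k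
  coprime⇒∃[j<p]∣1+j*k cop with coprime⇒∃[j]∣1+j*k cop
  ... | j , p∣1+jk = j % p , m%n<n j p , ∣1+j*k⇒∣1+[j%p]*k p∣1+jk

  entry≡0⇒∣entryℕ : ∀ m i j → entry p m i j ≡ 0 → p ∣ entryℕ m i j
  entry≡0⇒∣entryℕ m i j e≡0 = m%n≡0⇒n∣m _ p (trans (sym (entry≡entryℕ% m i j)) e≡0)

  ∣entryℕ⇒entry≡0 : ∀ m i j → p ∣ entryℕ m i j → entry p m i j ≡ 0
  ∣entryℕ⇒entry≡0 m i j p∣e = trans (entry≡entryℕ% m i j) (n∣m⇒m%n≡0 _ p p∣e)

  entry-1-1≡0⇒entry-3-3≡0 : ∀ m → entry p m 1 1 ≡ 0 → entry p m 3 3 ≡ 0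
  entry-1-1≡0⇒entry-3-3≡0 m e₁₁≡0 = ∣entryℕ⇒entry≡0 m 3 3
    (subst (p ∣_) (sym (entryℕ-3-3 m)) (∣m⇒∣m*n _ (entry≡0⇒∣entryℕ m 1 1 e₁₁≡0)))

  ∣1+j*[1+m]⇒entry-1-j≡0 : ∀ m j → p ∣ 1 + j * suc m → entry p m 1 j ≡ 0
  ∣1+j*[1+m]⇒entry-1-j≡0 m j p∣ = ∣entryℕ⇒entry≡0 m 1 j (subst (p ∣_) (sym (entryℕ-row₁ m j)) p∣)

  ∣1+j*[1+m]⇒entry-j-1≡0 : ∀ m j → p ∣ 1 + j * suc m → entry p m j 1 ≡ 0
  ∣1+j*[1+m]⇒entry-j-1≡0 m j p∣ = ∣entryℕ⇒entry≡0 m j 1 (subst (p ∣_) (sym (entryℕ-col₁ m j)) p∣)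

corollary5p2 : (p : ℕ) → .{{_ : NonZero p}} → Prime p → p > 3 →
    (m : ℕ) → m < p → m ≢ p ∸ 1 →
    Σ ℕ λ i₁ → Σ ℕ λ j₁ → Σ ℕ λ i₂ → Σ ℕ λ j₂ →
      i₁ < p × j₁ < p × i₂ < p × j₂ < p ×
      ¬ ((i₁ ≡ i₂) × (j₁ ≡ j₂)) ×
      entry p m i₁ j₁ ≡ 0 × entry p m i₂ j₂ ≡ 0
corollary5p2 p p-prime p>3 m m<p m≢p∸1
  with coprime⇒∃[j<p]∣1+j*k p (prime⇒coprime p-prime 1+m<p)
  where
  1+m<p : suc m < p
  1+m<p = ≤∧≢⇒< m<p (λ 1+m≡p → m≢p∸1 (cong pred 1+m≡p))
... | j , j<p , p∣1+j[1+m] with j ≟ 1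
...   | no j≢1 = 1 , j , j , 1 , 1<p , j<p , j<p , 1<p , (λ (1≡j , _) → j≢1 (sym 1≡j)) ,
                 ∣1+j*[1+m]⇒entry-1-j≡0 p m j p∣1+j[1+m] , ∣1+j*[1+m]⇒entry-j-1≡0 p m j p∣1+j[1+m]
  where
  1<p : 1 < p
  1<p = ≤-trans (s≤s (s≤s z≤n)) p>3
...   | yes refl = 1 , 1 , 3 , 3 , j<p , j<p , p>3 , p>3 , (λ ()) ,
                   e₁₁≡0 , entry-1-1≡0⇒entry-3-3≡0 p m e₁₁≡0
  where
  e₁₁≡0 : entry p m 1 1 ≡ 0
  e₁₁≡0 = ∣1+j*[1+m]⇒entry-1-j≡0 p m 1 p∣1+j[1+m]
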